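{- Let $\mathcal{CBP}$ denote the species of connected bipartite graphs and $\mathcal{CBC}$ the $\mathfrak S_2$-species of connected bicolored graphs with the color-switching action of $\mathfrak S_2=\{e,\tau\}$. Then $$Z_{\mathcal{CBP}}=\frac12\left(Z^{\mathfrak S_2}_{\mathcal{CBC}}(e)+Z^{\mathfrak S_2}_{\mathcal{CBC}}(\tau)\right).$$
   Context: A bicolored graph is a graph each vertex of which is colored black or white so that every edge joins vertices of different colors; a bipartite graph is a graph admitting such a coloring. Species structures on a set $A$ are such graphs with vertex set $A$ (nonempty), relabeled by bijections; $\tau$ acts by reversing all colors. The ordinary cycle index of a species $F$ is $Z_F=\sum_{n\ge0}\frac1{n!}\sum_{\sigma\in\mathfrak S_n}\mathrm{fix}(F[\sigma])\,p_\sigma$ and the $\Gamma$-cycle index of a $\Gamma$-species is $Z_F^{\Gamma}(\gamma)=\sum_{n\ge0}\frac1{n!}\sum_{\sigma\in\mathfrak S_n}\mathrm{fix}(\gamma\cdot F[\sigma])\,p_\sigma$, where $p_\sigma=p_1^{\sigma_1}p_2^{\sigma_2}\cdots$, $\sigma_i$ the number of $i$-cycles of $\sigma$, and $p_i$ are power sum symmetric functions. -}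

module Defs where

open import Data.Nat using (ℕ; zero; suc; _/_)
open import Data.Bool using (Bool; true; false; not)
open import Data.Fin using (Fin)
open import Data.Fin.Properties using (_≟_)
open import Data.Fin.Permutation using (Permutation′; _⟨$⟩ʳ_)
open import Data.List using (List; length; filter)
open import Data.List.Base using (allFin)
open import Data.Product using (Σ; ∃; _×_; _,_)
open import Relation.Nullary using (¬_; yes; no)
open import Relation.Binary.PropositionalEquality using (_≡_; _≢_)
import Data.Nat as N

record Graph (n : ℕ) : Set where
  field
    adj      : Fin n → Fin n → Bool
    sym      : ∀ i j → adj i j ≡ adj j i
    loopless : ∀ i → adj i i ≡ false
open Graph public

data Reach {n : ℕ} (G : Graph n) : Fin n → Fin n → Set where
  here : ∀ {i} → Reach G i i
  step : ∀ {i k j} → adj G i k ≡ true → Reach G k j → Reach G i j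

Connected : {n : ℕ} → Graph n → Set
Connected G = ∀ i j → Reach G i j

ProperColouring : {n : ℕ} → Graph n → (Fin n → Bool) → Set
ProperColouring G c = ∀ i j → adj G i j ≡ true → c i ≢ c j

Bipartite : {n : ℕ} → Graph n → Set
Bipartite G = Σ _ λ c → ProperColouring G c

FixedGraph : {n : ℕ} → Permutation′ n → Graph n → Set
FixedGraph σ G = ∀ i j → adj G (σ ⟨$⟩ʳ i) (σ ⟨$⟩ʳ j) ≡ adj G i j

-- colouring c is fixed by σ  (σ·c = c ∘ σ⁻¹)
FixedColour : {n : ℕ} → Permutation′ n → (Fin n → Bool) → Set
FixedColour σ c = ∀ i → c (σ ⟨$⟩ʳ i) ≡ c i

FixedColourτ : {n : ℕ} → Permutation′ n → (Fin n → Bool) → Set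
FixedColourτ σ c = ∀ i → c (σ ⟨$⟩ʳ i) ≡ not (c i)

iter : {n : ℕ} → Permutation′ n → ℕ → Fin n → Fin n
iter σ zero    x = x
iter σ (suc k) x = σ ⟨$⟩ʳ (iter σ k x)

period : {n : ℕ} → Permutation′ n → Fin n → ℕ
period {n} σ x = go 1 n
  where
  go : ℕ → ℕ → ℕ
  go k zero    = k
  go k (suc f) with iter σ k x ≟ x
  ... | yes _ = k
  ... | no  _ = go (suc k) f

-- σ_i : number of i-cycles of σ, for i ≥ 1 (given as suc i)
numCycles : {n : ℕ} → Permutation′ n → ℕ → ℕ
numCycles {n} σ i =
  length (filter (λ x → N._≟_ (period σ x) (suc i)) (allFin n)) / suc i

-- σ has cycle type μ, i.e. p_σ = p_1^{μ 0} p_2^{μ 1} p_3^{μ 2} ⋯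
HasCycleType : {n : ℕ} → Permutation′ n → (ℕ → ℕ) → Set
HasCycleType σ μ = ∀ i → numCycles σ i ≡ μ i

HasCard : (A : Set) → (A → A → Set) → ℕ → Set
HasCard A _≈_ k =
  Σ (Fin k → A) λ f → (∀ a b → f a ≈ f b → a ≡ b) × (∀ x → ∃ λ a → f a ≈ x)

SamePerm : {n : ℕ} → Permutation′ n → Permutation′ n → Set
SamePerm σ ρ = ∀ i → σ ⟨$⟩ʳ i ≡ ρ ⟨$⟩ʳ i

SameGraph : {n : ℕ} → Graph n → Graph n → Set
SameGraph G H = ∀ i j → adj G i j ≡ adj H i j

-- Pairs (σ , structure fixed by σ) with σ of cycle type μ, on vertex set
-- Fin (suc n) (species structures live on nonempty sets only).
-- Their number divided by (suc n)! is the coefficient of p_μ in the cycle index.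

FixCBP : ℕ → (ℕ → ℕ) → Set
FixCBP n μ = Σ (Permutation′ (suc n)) λ σ → Σ (Graph (suc n)) λ G →
  HasCycleType σ μ × Connected G × Bipartite G × FixedGraph σ G

SameCBP : ∀ {n μ} → FixCBP n μ → FixCBP n μ → Set
SameCBP (σ , G , _) (ρ , H , _) = SamePerm σ ρ × SameGraph G H

if' : Bool → Set → Set → Set
if' true  X Y = X
if' false X Y = Y

-- connected bicoloured graphs fixed by γ·CBC[σ]; γ = e (b = false) or γ = τ (b = true)
FixCBC : Bool → ℕ → (ℕ → ℕ) → Set
FixCBC b n μ = Σ (Permutation′ (suc n)) λ σ → Σ (Graph (suc n)) λ G →
  Σ (Fin (suc n) → Bool) λ c →
  HasCycleType σ μ × Connected G × ProperColouring G c × FixedGraph σ G ×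
  (if' b (FixedColourτ σ c) (FixedColour σ c))

SameCBC : ∀ b {n μ} → FixCBC b n μ → FixCBC b n μ → Set
SameCBC _ (σ , G , c , _) (ρ , H , d , _) =
  SamePerm σ ρ × SameGraph G H × (∀ i → c i ≡ d i)

-- A connected bipartite graph G has exactly two proper colourings, c and not ∘ c, told apart by the
-- colour of vertex 0. If σ fixes G then c ∘ σ is again proper, hence equal to c or to not ∘ c:
-- so σ fixes the coloured graph (G , c) either under e or under τ, and never under both. Thus
-- (σ , G , colour of vertex 0) ↦ (σ , G , c) identifies Bool × fix(CBP[σ]) with the disjoint union
-- of fix(CBC[σ]) and fix(τ · CBC[σ]), whence 2a = b + c.
module Submission where

open import Defs hiding (sym)
open import Data.Nat using (ℕ; suc; _+_; _*_; _≤_)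
open import Data.Nat.Properties using (≤-antisym)
open import Data.Bool using (Bool; true; false; not; _xor_)
open import Data.Bool.Properties using (¬-not; not-injective; xor-assoc; xor-same; xor-identityʳ)
open import Data.Fin using (Fin; zero; suc)
open import Data.Fin.Properties using (+↔⊎; *↔×; injective⇒≤)
open import Data.Fin.Permutation using (Permutation′; _⟨$⟩ʳ_)
open import Data.Product using (∃; _×_; _,_; proj₁; proj₂)
import Data.Product as Product
open import Data.Product.Relation.Binary.Pointwise.NonDependent as ×ᴾ using (×-isEquivalence)
open import Data.Sum using (_⊎_; inj₁; inj₂)
import Data.Sum as Sum
open import Data.Sum.Relation.Binary.Pointwise as ⊎ᴾ using (inj₁; inj₂; ⊎-isEquivalence)
open import Function using (_∘_; _↔_; Inverse)
open import Relation.Binary using (Rel; IsEquivalence)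
open import Relation.Binary.PropositionalEquality
  using (_≡_; refl; sym; trans; cong; cong₂; subst; ≢-sym; module ≡-Reasoning)
import Relation.Binary.PropositionalEquality as ≡

open ≡-Reasoning

private
  variable
    A B I : Set
    k l m : ℕ

HasCard-↔ : ∀ {_≈_ : Rel A _} (e : Fin m ↔ I) (F : I → A) →
            (∀ u v → F u ≈ F v → u ≡ v) → (∀ x → ∃ λ u → F u ≈ x) →
            HasCard A _≈_ m
HasCard-↔ {_≈_ = _≈_} e F F-reflects F-onto = F ∘ to , injective , onto
  where
  open Inverse e
  injective : ∀ i j → F (to i) ≈ F (to j) → i ≡ j
  injective i j p = begin
    i             ≡⟨ strictlyInverseʳ i ⟨
    from (to i)   ≡⟨ cong from (F-reflects _ _ p) ⟩
    from (to j)   ≡⟨ strictlyInverseʳ j ⟩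
    j             ∎
  onto : ∀ x → ∃ λ i → F (to i) ≈ x
  onto x = from u , subst (λ v → F v ≈ x) (sym (strictlyInverseˡ u)) Fu≈x
    where
    u = proj₁ (F-onto x)
    Fu≈x = proj₂ (F-onto x)

HasCard-Bool : HasCard Bool _≡_ 2
HasCard-Bool = toBool , injective , onto
  where
  toBool : Fin 2 → Bool
  toBool zero       = false
  toBool (suc zero) = true
  injective : ∀ i j → toBool i ≡ toBool j → i ≡ j
  injective zero       zero       _ = refl
  injective (suc zero) (suc zero) _ = refl
  injective zero       (suc zero) ()
  injective (suc zero) zero       ()
  onto : ∀ x → ∃ λ i → toBool i ≡ x
  onto false = zero , refl
  onto true  = suc zero , refl

HasCard-⊎ : ∀ {_≈₁_ : Rel A _} {_≈₂_ : Rel B _} →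
            HasCard A _≈₁_ k → HasCard B _≈₂_ l →
            HasCard (A ⊎ B) (⊎ᴾ.Pointwise _≈₁_ _≈₂_) (k + l)
HasCard-⊎ {_≈₁_ = _≈₁_} {_≈₂_} (f , f-inj , f-onto) (g , g-inj , g-onto) =
  HasCard-↔ {_≈_ = _≈_} +↔⊎ (Sum.map f g) reflects onto
  where
  _≈_ = ⊎ᴾ.Pointwise _≈₁_ _≈₂_
  reflects : ∀ u v → Sum.map f g u ≈ Sum.map f g v → u ≡ v
  reflects (inj₁ i) (inj₁ j) (inj₁ p) = cong inj₁ (f-inj i j p)
  reflects (inj₂ i) (inj₂ j) (inj₂ p) = cong inj₂ (g-inj i j p)
  onto : ∀ x → ∃ λ u → Sum.map f g u ≈ x
  onto (inj₁ a) = inj₁ (proj₁ (f-onto a)) , inj₁ (proj₂ (f-onto a))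
  onto (inj₂ b) = inj₂ (proj₁ (g-onto b)) , inj₂ (proj₂ (g-onto b))

HasCard-× : ∀ {_≈₁_ : Rel A _} {_≈₂_ : Rel B _} →
            HasCard A _≈₁_ k → HasCard B _≈₂_ l →
            HasCard (A × B) (×ᴾ.Pointwise _≈₁_ _≈₂_) (k * l)
HasCard-× {_≈₁_ = _≈₁_} {_≈₂_} (f , f-inj , f-onto) (g , g-inj , g-onto) =
  HasCard-↔ {_≈_ = _≈_} *↔× (Product.map f g) reflects onto
  where
  _≈_ = ×ᴾ.Pointwise _≈₁_ _≈₂_
  reflects : ∀ u v → Product.map f g u ≈ Product.map f g v → u ≡ v
  reflects (i , j) (i′ , j′) (p , q) = cong₂ _,_ (f-inj i i′ p) (g-inj j j′ q)
  onto : ∀ x → ∃ λ u → Product.map f g u ≈ x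
  onto (a , b) = (proj₁ (f-onto a) , proj₁ (g-onto b)) , (proj₂ (f-onto a) , proj₂ (g-onto b))

-- A map reflecting the equivalences lets every index of A pick an index of B.
HasCard-mono : ∀ {_≈₁_ : Rel A _} {_≈₂_ : Rel B _} →
               HasCard A _≈₁_ k → HasCard B _≈₂_ l → IsEquivalence _≈₂_ →
               (φ : A → B) → (∀ x y → φ x ≈₂ φ y → x ≈₁ y) → k ≤ l
HasCard-mono {_≈₂_ = _≈₂_} (f , f-inj , _) (g , _ , g-onto) ≈₂-equiv φ φ-reflects =
  injective⇒≤ {f = index} injective
  where
  open IsEquivalence ≈₂-equiv using () renaming (sym to ≈₂-sym; trans to ≈₂-trans)
  index = proj₁ ∘ g-onto ∘ φ ∘ f
  injective : ∀ {i j} → index i ≡ index j → i ≡ j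
  injective {i} {j} eq = f-inj i j (φ-reflects (f i) (f j) (≈₂-trans (≈₂-sym gi≈φfi) gi≈φfj))
    where
    gi≈φfi = proj₂ (g-onto (φ (f i)))
    gi≈φfj = subst (λ t → g t ≈₂ φ (f j)) (sym eq) (proj₂ (g-onto (φ (f j))))

xor-involutiveʳ : ∀ x y → (x xor y) xor y ≡ x
xor-involutiveʳ x y = begin
  (x xor y) xor y   ≡⟨ xor-assoc x y y ⟩
  x xor (y xor y)   ≡⟨ cong (x xor_) (xor-same y) ⟩
  x xor false       ≡⟨ xor-identityʳ x ⟩
  x                 ∎

xor-cancelʳ : ∀ {x y} z → x xor z ≡ y xor z → x ≡ y
xor-cancelʳ {x} {y} z eq = begin
  x                 ≡⟨ xor-involutiveʳ x z ⟨
  (x xor z) xor z   ≡⟨ cong (_xor z) eq ⟩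
  (y xor z) xor z   ≡⟨ xor-involutiveʳ y z ⟩
  y                 ∎

xor-injectiveˡ : ∀ t {x y} → t xor x ≡ t xor y → x ≡ y
xor-injectiveˡ false eq = eq
xor-injectiveˡ true  eq = not-injective eq

module _ {m : ℕ} (G : Graph m) where

  ProperColouring-xor : ∀ {c} t → ProperColouring G c → ProperColouring G (λ i → t xor c i)
  ProperColouring-xor t proper i j edge = proper i j edge ∘ xor-injectiveˡ t

  ProperColouring-∘ : ∀ {c σ} → FixedGraph σ G → ProperColouring G c →
                      ProperColouring G (λ i → c (σ ⟨$⟩ʳ i))
  ProperColouring-∘ {σ = σ} fixed proper i j edge =
    proper (σ ⟨$⟩ʳ i) (σ ⟨$⟩ʳ j) (trans (fixed i j) edge)

  ProperColouring-cong : ∀ {H c} → SameGraph G H → ProperColouring H c → ProperColouring G c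
  ProperColouring-cong G≈H proper i j edge = proper i j (trans (sym (G≈H i j)) edge)

  -- Along an edge both colourings change, and Bool has only two values.
  ProperColourings-agree : ∀ {c d i j} → ProperColouring G c → ProperColouring G d →
                           Reach G i j → c i ≡ d i → c j ≡ d j
  ProperColourings-agree c-proper d-proper here         eq = eq
  ProperColourings-agree {c} {d} c-proper d-proper (step {i} {k} edge path) eq =
    ProperColourings-agree c-proper d-proper path (begin
      c k       ≡⟨ ¬-not (≢-sym (c-proper i k edge)) ⟩
      not (c i) ≡⟨ cong not eq ⟩
      not (d i) ≡⟨ ¬-not (≢-sym (d-proper i k edge)) ⟨
      d k       ∎)

  connected⇒ProperColourings-agree : ∀ {c d} v → Connected G →
    ProperColouring G c → ProperColouring G d → c v ≡ d v → ∀ i → c i ≡ d i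
  connected⇒ProperColourings-agree v connected c-proper d-proper eq i =
    ProperColourings-agree c-proper d-proper (connected v i) eq

-- σ · c = t · c, with t = false standing for e and t = true for τ.
FixedColourUpTo : Bool → Permutation′ m → (Fin m → Bool) → Set
FixedColourUpTo t σ c = ∀ i → c (σ ⟨$⟩ʳ i) ≡ t xor c i

FixedColourIf : Bool → Permutation′ m → (Fin m → Bool) → Set
FixedColourIf t σ c = if' t (FixedColourτ σ c) (FixedColour σ c)

FixedColourIf⇒UpTo : ∀ t {σ : Permutation′ m} {c} → FixedColourIf t σ c → FixedColourUpTo t σ c
FixedColourIf⇒UpTo false fixed = fixed
FixedColourIf⇒UpTo true  fixed = fixed

FixedColourUpTo⇒If : ∀ t {σ : Permutation′ m} {c} → FixedColourUpTo t σ c → FixedColourIf t σ c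
FixedColourUpTo⇒If false fixed = fixed
FixedColourUpTo⇒If true  fixed = fixed

FixedColourUpTo-unique : ∀ {t t′} {σ : Permutation′ m} {c} (v : Fin m) →
  FixedColourUpTo t σ c → FixedColourUpTo t′ σ c → t ≡ t′
FixedColourUpTo-unique {c = c} v fixed fixed′ =
  xor-cancelʳ (c v) (trans (sym (fixed v)) (fixed′ v))

-- c ∘ σ and t xor c are both proper, so they agree everywhere as soon as they agree at v.
connected⇒FixedColourUpTo : ∀ {G : Graph m} {σ c} (v : Fin m) → Connected G → FixedGraph σ G →
  ProperColouring G c → FixedColourUpTo (c (σ ⟨$⟩ʳ v) xor c v) σ c
connected⇒FixedColourUpTo {G = G} {σ} {c} v connected fixed proper =
  connected⇒ProperColourings-agree G v connected
    (ProperColouring-∘ G {c} {σ} fixed proper) (ProperColouring-xor G {c} t proper)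
    (sym (xor-involutiveʳ (c (σ ⟨$⟩ʳ v)) (c v)))
  where t = c (σ ⟨$⟩ʳ v) xor c v

module _ {n : ℕ} {μ : ℕ → ℕ} where

  private
    v₀ : Fin (suc n)
    v₀ = zero

  perm : ∀ t → FixCBC t n μ → Permutation′ (suc n)
  perm _ (σ , _) = σ

  graph : ∀ t → FixCBC t n μ → Graph (suc n)
  graph _ (_ , G , _) = G

  colouring : ∀ t → FixCBC t n μ → Fin (suc n) → Bool
  colouring _ (_ , _ , c , _) = c

  SameUnderlying : ∀ t t′ → FixCBC t n μ → FixCBC t′ n μ → Set
  SameUnderlying t t′ x y =
    SamePerm (perm t x) (perm t′ y) × SameGraph (graph t x) (graph t′ y) ×
    (∀ i → colouring t x i ≡ colouring t′ y i)

  forgetColouring : ∀ t → FixCBC t n μ → FixCBP n μ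
  forgetColouring _ (σ , G , c , cycleType , connected , proper , fixedG , _) =
    σ , G , cycleType , connected , (c , proper) , fixedG

  SameCBP-isEquivalence : IsEquivalence (SameCBP {n} {μ})
  SameCBP-isEquivalence = record
    { refl  = (λ _ → refl) , (λ _ _ → refl)
    ; sym   = λ (σ≈ρ , G≈H) → (λ i → sym (σ≈ρ i)) , (λ i j → sym (G≈H i j))
    ; trans = λ (σ≈ρ , G≈H) (ρ≈π , H≈K) →
                (λ i → trans (σ≈ρ i) (ρ≈π i)) , (λ i j → trans (G≈H i j) (H≈K i j))
    }

  SameCBC-isEquivalence : ∀ t → IsEquivalence (SameCBC t {n} {μ})
  SameCBC-isEquivalence t = record
    { refl  = (λ _ → refl) , (λ _ _ → refl) , (λ _ → refl)
    ; sym   = λ (σ≈ρ , G≈H , c≈d) →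
                (λ i → sym (σ≈ρ i)) , (λ i j → sym (G≈H i j)) , (λ i → sym (c≈d i))
    ; trans = λ (σ≈ρ , G≈H , c≈d) (ρ≈π , H≈K , d≈e) →
                (λ i → trans (σ≈ρ i) (ρ≈π i)) , (λ i j → trans (G≈H i j) (H≈K i j)) ,
                (λ i → trans (c≈d i) (d≈e i))
    }

  FixCBC-determined : ∀ t t′ (x : FixCBC t n μ) (y : FixCBC t′ n μ) →
    SameCBP (forgetColouring t x) (forgetColouring t′ y) →
    colouring t x v₀ ≡ colouring t′ y v₀ →
    t ≡ t′ × (∀ i → colouring t x i ≡ colouring t′ y i)
  FixCBC-determined t t′ (σ , G , c , _ , connected , c-proper , _ , c-fixed)
                         (ρ , H , d , _ , _ , d-proper , _ , d-fixed) (σ≈ρ , G≈H) eq =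
    t≡t′ , c≈d
    where
    c≈d = connected⇒ProperColourings-agree G {c} {d} v₀ connected c-proper
            (ProperColouring-cong G {H} {d} G≈H d-proper) eq
    c-fixed′ : FixedColourUpTo t′ σ c
    c-fixed′ i = begin
      c (σ ⟨$⟩ʳ i)   ≡⟨ c≈d (σ ⟨$⟩ʳ i) ⟩
      d (σ ⟨$⟩ʳ i)   ≡⟨ cong d (σ≈ρ i) ⟩
      d (ρ ⟨$⟩ʳ i)   ≡⟨ FixedColourIf⇒UpTo t′ {ρ} {d} d-fixed i ⟩
      t′ xor d i     ≡⟨ cong (t′ xor_) (c≈d i) ⟨
      t′ xor c i     ∎
    t≡t′ = FixedColourUpTo-unique {σ = σ} {c} v₀ (FixedColourIf⇒UpTo t {σ} {c} c-fixed) c-fixed′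

  FixCBC± : Set
  FixCBC± = FixCBC false n μ ⊎ FixCBC true n μ

  SameCBC± : Rel FixCBC± _
  SameCBC± = ⊎ᴾ.Pointwise (SameCBC false) (SameCBC true)

  inject : ∀ t → FixCBC t n μ → FixCBC±
  inject false = inj₁
  inject true  = inj₂

  inject-reflects : ∀ t t′ (x : FixCBC t n μ) (y : FixCBC t′ n μ) →
                    SameCBC± (inject t x) (inject t′ y) → SameUnderlying t t′ x y
  inject-reflects false false x y (inj₁ x≈y) = x≈y
  inject-reflects true  true  x y (inj₂ x≈y) = x≈y

  colourAtZeroAndForget : FixCBC± → Bool × FixCBP n μ
  colourAtZeroAndForget (inj₁ x) = colouring false x v₀ , forgetColouring false x
  colourAtZeroAndForget (inj₂ x) = colouring true x v₀ , forgetColouring true x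

  colourAtZeroAndForget-reflects : ∀ x y →
    ×ᴾ.Pointwise _≡_ SameCBP (colourAtZeroAndForget x) (colourAtZeroAndForget y) → SameCBC± x y
  colourAtZeroAndForget-reflects (inj₁ x) (inj₁ y) (eq , σ≈ρ , G≈H) =
    inj₁ (σ≈ρ , G≈H , proj₂ (FixCBC-determined false false x y (σ≈ρ , G≈H) eq))
  colourAtZeroAndForget-reflects (inj₂ x) (inj₂ y) (eq , σ≈ρ , G≈H) =
    inj₂ (σ≈ρ , G≈H , proj₂ (FixCBC-determined true true x y (σ≈ρ , G≈H) eq))
  colourAtZeroAndForget-reflects (inj₁ x) (inj₂ y) (eq , σ≈ρ , G≈H)
    with () ← proj₁ (FixCBC-determined false true x y (σ≈ρ , G≈H) eq)
  colourAtZeroAndForget-reflects (inj₂ x) (inj₁ y) (eq , σ≈ρ , G≈H)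
    with () ← proj₁ (FixCBC-determined true false x y (σ≈ρ , G≈H) eq)

  -- Recolour so that v₀ gets colour β, then file the result under the twist by which σ acts.
  colourAtZero : Bool → FixCBP n μ → FixCBC±
  colourAtZero β (σ , G , cycleType , connected , (c , proper) , fixedG) =
    inject t (σ , G , c′ , cycleType , connected , proper′ , fixedG ,
              FixedColourUpTo⇒If t {σ} {c′}
                (connected⇒FixedColourUpTo {G = G} {σ} {c′} v₀ connected fixedG proper′))
    where
    c′ = λ i → (β xor c v₀) xor c i
    proper′ = ProperColouring-xor G {c} (β xor c v₀) proper
    t = c′ (σ ⟨$⟩ʳ v₀) xor c′ v₀

  colourAtZero-reflects : ∀ u v →
    SameCBC± (Product.uncurry colourAtZero u) (Product.uncurry colourAtZero v) →
    ×ᴾ.Pointwise _≡_ SameCBP u v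
  colourAtZero-reflects (β , σ , G , _ , _ , (c , _) , _) (β′ , ρ , H , _ , _ , (d , _) , _) same =
    β≡β′ , σ≈ρ , G≈H
    where
    underlying = inject-reflects _ _ _ _ same
    σ≈ρ = proj₁ underlying
    G≈H = proj₁ (proj₂ underlying)
    β≡β′ = begin
      β                         ≡⟨ xor-involutiveʳ β (c v₀) ⟨
      (β xor c v₀) xor c v₀     ≡⟨ proj₂ (proj₂ underlying) v₀ ⟩
      (β′ xor d v₀) xor d v₀    ≡⟨ xor-involutiveʳ β′ (d v₀) ⟩
      β′                        ∎

mainTheorem4 : (n : ℕ) (μ : ℕ → ℕ) (a b c : ℕ) →
    HasCard (FixCBP n μ) SameCBP a →
    HasCard (FixCBC false n μ) (SameCBC false) b →
    HasCard (FixCBC true n μ) (SameCBC true) c →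
    2 * a ≡ b + c
mainTheorem4 n μ a b c cbp cbcᵉ cbcᵗ = ≤-antisym
  (HasCard-mono {_≈₁_ = ×ᴾ.Pointwise _≡_ SameCBP} {_≈₂_ = SameCBC±} coloured± cbc±
    (⊎-isEquivalence (SameCBC-isEquivalence false) (SameCBC-isEquivalence true))
    (Product.uncurry colourAtZero) colourAtZero-reflects)
  (HasCard-mono {_≈₁_ = SameCBC±} {_≈₂_ = ×ᴾ.Pointwise _≡_ SameCBP} cbc± coloured±
    (×-isEquivalence ≡.isEquivalence SameCBP-isEquivalence)
    colourAtZeroAndForget colourAtZeroAndForget-reflects)
  where
  coloured± = HasCard-× {_≈₁_ = _≡_} {_≈₂_ = SameCBP} HasCard-Bool cbp
  cbc± = HasCard-⊎ {_≈₁_ = SameCBC false} {_≈₂_ = SameCBC true} cbcᵉ cbcᵗ
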